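{- Let $S$ be a set of nonnegative integers with $0,1\in S$. Let $n$ be a positive integer and let $\mathbf{a}=(a_1,\dots,a_k)$ be a vector of positive integers with $a_1\le a_2\le\cdots\le a_k$ such that $V'_S(\mathbf{a})=\mathcal T(n)$. Then $(n,n+1,n+2,\dots,2n-1)\preceq\mathbf{a}$. Furthermore, if $2\notin S$, then $\mathbf{x}_n\preceq\mathbf{a}$ or $\mathbf{y}_n\preceq\mathbf{a}$, where $\mathbf{x}_n=(n,n,n+1,n+2,\dots,2n-1)$ and $\mathbf{y}_n=(n,n+1,n+2,\dots,2n)$.
   Context: For a vector $\mathbf{a}=(a_1,\dots,a_k)$ of positive integers and a set $S$ of nonnegative integers, $V_S(\mathbf{a})=\{a_1s_1+\cdots+a_ks_k : s_i\in S\}$ and $V'_S(\mathbf{a})=V_S(\mathbf{a})\setminus\{0\}$. For a positive integer $n$, $\mathcal T(n)$ is the set of integers greater than or equal to $n$. For vectors $\mathbf{u}=(u_1,\dots,u_r)$ and $\mathbf{v}=(v_1,\dots,v_s)$ of positive integers, $\mathbf{u}\preceq\mathbf{v}$ means that the sequence $(u_i)_{1\le i\le r}$ is a subsequence of $(v_j)_{1\le j\le s}$. -}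

module Defs where

open import Data.Nat using (ℕ; zero; suc; _+_; _*_; _≤_; _≥_)
open import Data.List using (List; []; _∷_; applyUpTo)
open import Data.List.Relation.Unary.All using (All)
open import Data.Product using (Σ; _×_)
open import Relation.Binary.PropositionalEquality using (_≡_)
open import Relation.Nullary using (¬_)

dot : List ℕ → List ℕ → ℕ
dot (a ∷ as) (s ∷ ss) = a * s + dot as ss
dot _ _ = 0

data Choice (S : ℕ → Set) : List ℕ → List ℕ → Set where
  []  : Choice S [] []
  _∷_ : ∀ {a as s ss} → S s → Choice S as ss → Choice S (a ∷ as) (s ∷ ss)

InV : (S : ℕ → Set) → List ℕ → ℕ → Set
InV S a m = Σ (List ℕ) λ s → Choice S a s × dot a s ≡ m

InV' : (S : ℕ → Set) → List ℕ → ℕ → Set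
InV' S a m = InV S a m × ¬ (m ≡ 0)

InT : ℕ → ℕ → Set
InT n m = m ≥ n

data NonDecr : List ℕ → Set where
  []  : NonDecr []
  [_] : ∀ x → NonDecr (x ∷ [])
  _∷_ : ∀ {x y ys} → x ≤ y → NonDecr (y ∷ ys) → NonDecr (x ∷ y ∷ ys)

range : ℕ → ℕ → List ℕ
range n len = applyUpTo (λ i → n + i) len

xvec : ℕ → List ℕ
xvec n = n ∷ range n n

yvec : ℕ → List ℕ
yvec n = range n (suc n)

-- Every entry of a lies in V'_S(a), so all entries are ≥ n. Then a nonzero
-- value Σ aᵢsᵢ uses either one coefficient ≥ 2 or two nonzero coefficients
-- (and is then ≥ 2n), or it is a single entry aᵢ with sᵢ = 1. Hence each m
-- with n ≤ m < 2n is an entry of a, and since a is sorted, n, …, 2n-1 occur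
-- in order. If 2 ∉ S, a representation of 2n must be 2n itself or n + n
-- with two distinct entries equal to n.
module Submission where

open import Defs
open import Data.Nat using (ℕ; _>_; zero; suc; _+_; _*_; _≤_; _<_; z<s; _≟_)
open import Data.Nat.Properties
open import Data.List using (List; []; _∷_; applyUpTo)
open import Data.List.Membership.Propositional using (_∈_)
open import Data.List.Membership.Propositional.Properties using (∈-applyUpTo⁻)
open import Data.List.Relation.Unary.All as All using (All; []; _∷_)
open import Data.List.Relation.Unary.AllPairs as AllPairs using ()
open import Data.List.Relation.Unary.Any using (here; there)
open import Data.List.Relation.Unary.Linked as Linked using (Linked; []; [-]; _∷_)
open import Data.List.Relation.Unary.Linked.Properties using (Linked⇒AllPairs)
open import Data.List.Relation.Binary.Sublist.Propositional
  using (_⊆_; _∷_; _∷ʳ_; minimum; from∈; to∈)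
open import Data.List.Relation.Binary.Sublist.Propositional.Properties using (∷⁻)
open import Data.Product using (_×_; _,_)
open import Data.Sum as Sum using (_⊎_; inj₁; inj₂)
open import Data.Empty using (⊥-elim)
open import Function.Base using (_∘_)
open import Function.Bundles using (_⇔_; Equivalence)
open import Relation.Binary.Definitions using (Transitive)
open import Relation.Binary.Core using (Rel)
open import Relation.Nullary using (¬_; yes; no)
open import Relation.Binary.PropositionalEquality

NonDecr⇒Linked : ∀ {a} → NonDecr a → Linked _≤_ a
NonDecr⇒Linked []       = []
NonDecr⇒Linked [ x ]    = [-]
NonDecr⇒Linked (p ∷ ps) = p ∷ NonDecr⇒Linked ps

Linked⇒All-head : ∀ {ℓ} {R : Rel ℕ ℓ} → Transitive R →
                  ∀ {x xs} → Linked R (x ∷ xs) → All (R x) xs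
Linked⇒All-head trans = AllPairs.head ∘ Linked⇒AllPairs trans

∈-tail : ∀ {z y : ℕ} {ys} → z ∈ y ∷ ys → z ≢ y → z ∈ ys
∈-tail (here z≡y) z≢y = ⊥-elim (z≢y z≡y)
∈-tail (there z∈) _   = z∈

∈-drop-smaller : ∀ {y : ℕ} {ys zs} → All (y <_) zs → All (_∈ y ∷ ys) zs → All (_∈ ys) zs
∈-drop-smaller y<zs zs∈ = All.zipWith (λ (y<z , z∈) → ∈-tail z∈ (>⇒≢ y<z)) (y<zs , zs∈)

⊆-sorted : ∀ {xs ys} → Linked _<_ xs → Linked _≤_ ys → All (_∈ ys) xs → xs ⊆ ys
⊆-sorted {[]}     _    _    _   = minimum _
⊆-sorted {x ∷ xs} {y ∷ ys} x<xs y≤ys (x∈ ∷ xs∈) with x ≟ y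
... | yes refl = refl ∷ ⊆-sorted (Linked.tail x<xs) (Linked.tail y≤ys)
                          (∈-drop-smaller (Linked⇒All-head <-trans x<xs) xs∈)
... | no  x≢y  = y ∷ʳ ⊆-sorted x<xs (Linked.tail y≤ys)
                          (∈-drop-smaller (y<x ∷ All.map (<-trans y<x) (Linked⇒All-head <-trans x<xs))
                                          (x∈ ∷ xs∈))
  where
  y<x : y < x
  y<x = ≤∧≢⇒< (All.lookup (Linked⇒All-head ≤-trans y≤ys) (∈-tail x∈ x≢y)) (x≢y ∘ sym)

applyUpTo-Linked : ∀ {f : ℕ → ℕ} → (∀ i → f i < f (suc i)) → ∀ len → Linked _<_ (applyUpTo f len)
applyUpTo-Linked f< zero          = []
applyUpTo-Linked f< (suc zero)    = [-]
applyUpTo-Linked f< (suc (suc l)) = f< 0 ∷ applyUpTo-Linked (f< ∘ suc) (suc l)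

range⊆ : ∀ {k len a} → Linked _≤_ a → (∀ i → i < len → k + i ∈ a) → range k len ⊆ a
range⊆ {k} {len} {a} a≤ mem =
  ⊆-sorted (applyUpTo-Linked (λ i → +-monoʳ-< k (n<1+n i)) len) a≤ (All.tabulate entry∈)
  where
  entry∈ : ∀ {v} → v ∈ range k len → v ∈ a
  entry∈ v∈ with i , i<len , refl ← ∈-applyUpTo⁻ (k +_) v∈ = mem i i<len

dot-0∷ : ∀ x as ss → dot (x ∷ as) (0 ∷ ss) ≡ dot as ss
dot-0∷ x as ss = cong (_+ dot as ss) (*-zeroʳ x)

dot-1∷ : ∀ x as ss → dot (x ∷ as) (1 ∷ ss) ≡ x + dot as ss
dot-1∷ x as ss = cong (_+ dot as ss) (*-identityʳ x)

module _ {S : ℕ → Set} (S0 : S 0) where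

  InV-zero : ∀ a → InV S a 0
  InV-zero []      = [] , [] , refl
  InV-zero (x ∷ a) with s , c , s·a≡0 ← InV-zero a =
    0 ∷ s , S0 ∷ c , trans (dot-0∷ x a s) s·a≡0

  InV-∈ : S 1 → ∀ {x a} → x ∈ a → InV S a x
  InV-∈ S1 {a = y ∷ a} (here refl) with s , c , s·a≡0 ← InV-zero a =
    1 ∷ s , S1 ∷ c , trans (dot-1∷ y a s) (trans (cong (y +_) s·a≡0) (+-identityʳ y))
  InV-∈ S1 {a = y ∷ a} (there x∈) with s , c , s·a≡x ← InV-∈ S1 x∈ =
    0 ∷ s , S0 ∷ c , trans (dot-0∷ y a s) s·a≡x

module _ {n : ℕ} where

  n+n≤x*[2+c] : ∀ {x} c → n ≤ x → n + n ≤ x * suc (suc c)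
  n+n≤x*[2+c] {x} c n≤x = begin
    n + n               ≤⟨ +-mono-≤ n≤x (≤-trans n≤x (m≤m*n x (suc c))) ⟩
    x + x * suc c       ≡⟨ *-suc x (suc c) ⟨
    x * suc (suc c)     ∎
    where open ≤-Reasoning

  +≡n+n⇒≡n : ∀ {x y} → n ≤ x → n ≤ y → x + y ≡ n + n → x ≡ n × y ≡ n
  +≡n+n⇒≡n {x} {y} n≤x n≤y x+y≡n+n =
    x≡n , +-cancelˡ-≡ n y n (subst (λ z → z + y ≡ n + n) x≡n x+y≡n+n)
    where
    x≡n : x ≡ n
    x≡n = ≤-antisym (+-cancelʳ-≤ n x n (≤-trans (+-monoʳ-≤ x n≤y) (≤-reflexive x+y≡n+n))) n≤x

  dot≥ : ∀ {a} s → All (n ≤_) a → dot a s ≢ 0 → n ≤ dot a s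
  dot≥ {[]}     _            _          ≢0 = ⊥-elim (≢0 refl)
  dot≥ {x ∷ as} []           _          ≢0 = ⊥-elim (≢0 refl)
  dot≥ {x ∷ as} (zero  ∷ ss) (_ ∷ n≤as) ≢0 rewrite dot-0∷ x as ss = dot≥ ss n≤as ≢0
  dot≥ {x ∷ as} (suc c ∷ ss) (n≤x ∷ _)  _  =
    ≤-trans n≤x (≤-trans (m≤m*n x (suc c)) (m≤m+n _ _))

  dot<n+n⇒∈ : ∀ {a m} s → All (n ≤_) a → dot a s ≡ m → m ≢ 0 → m < n + n → m ∈ a
  dot<n+n⇒∈ {[]}     _  _ refl m≢0 _ = ⊥-elim (m≢0 refl)
  dot<n+n⇒∈ {x ∷ as} [] _ refl m≢0 _ = ⊥-elim (m≢0 refl)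
  dot<n+n⇒∈ {x ∷ as} (zero ∷ ss) (_ ∷ n≤as) refl m≢0 m<n+n rewrite dot-0∷ x as ss =
    there (dot<n+n⇒∈ ss n≤as refl m≢0 m<n+n)
  dot<n+n⇒∈ {x ∷ as} (suc zero ∷ ss) (n≤x ∷ n≤as) refl _ m<n+n
    rewrite dot-1∷ x as ss with dot as ss ≟ 0
  ... | yes rest≡0 = here (trans (cong (x +_) rest≡0) (+-identityʳ x))
  ... | no  rest≢0 = ⊥-elim (<⇒≱ m<n+n (+-mono-≤ n≤x (dot≥ ss n≤as rest≢0)))
  dot<n+n⇒∈ {x ∷ as} (suc (suc c) ∷ ss) (n≤x ∷ _) refl _ m<n+n =
    ⊥-elim (<⇒≱ m<n+n (≤-trans (n+n≤x*[2+c] c n≤x) (m≤m+n _ _)))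

  dot≡n+n : ∀ {S a s} → ¬ S 2 → n > 0 → Choice S a s → All (n ≤_) a → dot a s ≡ n + n →
            n + n ∈ a ⊎ (n ∷ n ∷ []) ⊆ a
  dot≡n+n _ n>0 [] [] 0≡n+n = ⊥-elim (<⇒≢ (<-≤-trans n>0 (m≤m+n n n)) 0≡n+n)
  dot≡n+n {s = zero ∷ ss} ¬S2 n>0 (_ ∷ c) (_∷_ {x = x} {xs = as} _ n≤as) eq =
    Sum.map there (x ∷ʳ_) (dot≡n+n ¬S2 n>0 c n≤as (trans (sym (dot-0∷ x as ss)) eq))
  dot≡n+n {s = suc zero ∷ ss} _ n>0 (_ ∷ c) (_∷_ {x = x} {xs = as} n≤x n≤as) eq
    rewrite dot-1∷ x as ss with dot as ss ≟ 0
  ... | yes rest≡0 = inj₁ (here (trans (sym eq) (trans (cong (x +_) rest≡0) (+-identityʳ x))))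
  ... | no  rest≢0 with x≡n , rest≡n ← +≡n+n⇒≡n n≤x (dot≥ ss n≤as rest≢0) eq =
    inj₂ (sym x≡n ∷ from∈ (dot<n+n⇒∈ ss n≤as rest≡n (>⇒≢ n>0) (m<m+n n n>0)))
  dot≡n+n {s = suc (suc zero) ∷ _} ¬S2 _ (S2 ∷ _) _ _ = ⊥-elim (¬S2 S2)
  dot≡n+n {s = suc (suc (suc c)) ∷ ss} _ n>0 (_ ∷ _) (_∷_ {x = x} {xs = as} n≤x _) eq =
    ⊥-elim (<⇒≢ n+n<dot (sym eq))
    where
    open ≤-Reasoning
    n+n<dot : n + n < dot (x ∷ as) (suc (suc (suc c)) ∷ ss)
    n+n<dot = begin-strict
      n + n                         <⟨ m<n+m (n + n) n>0 ⟩
      n + (n + n)                   ≤⟨ +-mono-≤ n≤x (n+n≤x*[2+c] c n≤x) ⟩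
      x + x * suc (suc c)           ≡⟨ *-suc x (suc (suc c)) ⟨
      x * suc (suc (suc c))         ≤⟨ m≤m+n _ _ ⟩
      dot (x ∷ as) (suc (suc (suc c)) ∷ ss) ∎

xvec⊆ : ∀ {n a} → Linked _≤_ a → All (n ≤_) a → (∀ i → i < n → n + i ∈ a) →
        (n ∷ n ∷ []) ⊆ a → xvec n ⊆ a
xvec⊆ {n} {x ∷ a} x≤a n≤xa mem nn⊆ = sym x≡n ∷ range⊆ (Linked.tail x≤a) mem′
  where
  n∈a : n ∈ a
  n∈a = to∈ (∷⁻ nn⊆)
  x≡n : x ≡ n
  x≡n = ≤-antisym (All.lookup (Linked⇒All-head ≤-trans x≤a) n∈a) (All.head n≤xa)
  mem′ : ∀ i → i < n → n + i ∈ a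
  mem′ zero    _   = subst (_∈ a) (sym (+-identityʳ n)) n∈a
  mem′ (suc i) i<n =
    ∈-tail (mem (suc i) i<n) (>⇒≢ (subst (_< n + suc i) (sym x≡n) (m<m+n n z<s)))

lemma2p3 : (S : ℕ → Set) → S 0 → S 1 → (n : ℕ) → n > 0 →
    (a : List ℕ) → All (λ x → x > 0) a → NonDecr a →
    (∀ m → InV' S a m ⇔ InT n m) →
    (range n n ⊆ a) × (¬ S 2 → (xvec n ⊆ a) ⊎ (yvec n ⊆ a))
lemma2p3 S S0 S1 n n>0 a a>0 sorted V'⇔T = range⊆ a≤ below-2n∈a , two-cases
  where
  a≤ : Linked _≤_ a
  a≤ = NonDecr⇒Linked sorted
  n≤a : All (n ≤_) a
  n≤a = All.tabulate λ x∈ →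
    Equivalence.to (V'⇔T _) (InV-∈ S0 S1 x∈ , >⇒≢ (All.lookup a>0 x∈))
  below-2n∈a : ∀ i → i < n → n + i ∈ a
  below-2n∈a i i<n
    with (s , _ , s·a≡n+i) , n+i≢0 ← Equivalence.from (V'⇔T (n + i)) (m≤m+n n i) =
    dot<n+n⇒∈ s n≤a s·a≡n+i n+i≢0 (+-monoʳ-< n i<n)
  two-cases : ¬ S 2 → (xvec n ⊆ a) ⊎ (yvec n ⊆ a)
  two-cases ¬S2 with (_ , c , s·a≡2n) , _ ← Equivalence.from (V'⇔T (n + n)) (m≤m+n n n)
                with dot≡n+n ¬S2 n>0 c n≤a s·a≡2n
  ... | inj₂ nn⊆a = inj₁ (xvec⊆ a≤ n≤a below-2n∈a nn⊆a)
  ... | inj₁ 2n∈a = inj₂ (range⊆ a≤ upto-2n∈a)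
    where
    upto-2n∈a : ∀ i → i < suc n → n + i ∈ a
    upto-2n∈a i i≤n with m≤n⇒m<n∨m≡n (≤-pred i≤n)
    ... | inj₁ i<n  = below-2n∈a i i<n
    ... | inj₂ refl = 2n∈a
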